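{- For integers $n\ge1$ and $k,\bar k\ge0$, let $C(n,k,\bar k)$ be the number of signed permutations of $n$ whose decreasing Lyndon factorisation has exactly $k$ factors with an odd number of positive letters and exactly $\bar k$ factors with an even number of positive letters. Then $$C(n,k,\bar k)=2^{n-k-\bar k}\,c(n,k+\bar k)\binom{k+\bar k}{k},$$ where $c(n,j)$ is the signless Stirling number of the first kind (the number of permutations of $\{1,\dots,n\}$ with $j$ left-to-right minima, equivalently with $j$ cycles).
   Context: A signed permutation of $n$ is a word of length $n$ in which, for each $i\in\{1,\dots,n\}$, exactly one of the letters $i$ (positive) or $\bar i$ (negative) appears, exactly once. Letters are totally ordered by $\bar1\prec1\prec\bar2\prec2\prec\cdots$. A word is Lyndon if it is strictly lexicographically smaller than all its nontrivial cyclic rearrangements; the decreasing Lyndon factorisation of a word $w$ is the unique expression $w=u_1u_2\cdots u_r$ as a concatenation of Lyndon words with $u_1\succeq u_2\succeq\cdots\succeq u_r$ lexicographically (for words with distinct letters, the factors begin exactly at the left-to-right minima of $w$). -}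

module Defs where

open import Data.Nat using (ℕ; zero; suc; _+_; _*_; _<_; _<ᵇ_; _%_)
open import Data.Bool using (Bool; true; false; if_then_else_; not)
open import Data.Product using (_×_; _,_; proj₁; proj₂; ∃-syntax)
open import Data.Sum using (_⊎_)
open import Data.List using (List; []; _∷_; _++_; map; length; filterᵇ; upTo; concat)
open import Data.List.Relation.Binary.Permutation.Propositional using (_↭_)
open import Data.List.Relation.Unary.All using (All)
open import Data.List.Relation.Unary.Linked using (Linked)
open import Data.Maybe using (Maybe; just; nothing)
open import Relation.Binary.PropositionalEquality using (_≡_)
open import Relation.Nullary using (¬_)
import Data.List.Relation.Unary.Unique.Propositional
import Data.List.Membership.Propositional

-- A letter: (i , true) is the positive letter i, (i , false) is the negative letter ī.
Letter : Set
Letter = ℕ × Bool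

-- Total order  1̄ ≺ 1 ≺ 2̄ ≺ 2 ≺ …  encoded by the key 2i (for ī) / 2i+1 (for i).
key : Letter → ℕ
key (i , b) = 2 * i + (if b then 1 else 0)

_≺_ : Letter → Letter → Set
a ≺ b = key a < key b

Word : Set
Word = List Letter

data _<lex_ : Word → Word → Set where
  []<∷  : ∀ {y ys} → [] <lex (y ∷ ys)
  here  : ∀ {x y xs ys} → x ≺ y → (x ∷ xs) <lex (y ∷ ys)
  there : ∀ {x y xs ys} → key x ≡ key y → xs <lex ys → (x ∷ xs) <lex (y ∷ ys)

_⪰lex_ : Word → Word → Set
u ⪰lex v = (v <lex u) ⊎ (u ≡ v)

NonEmpty : Word → Set
NonEmpty w = ¬ (w ≡ [])

IsLyndon : Word → Set
IsLyndon w = NonEmpty w ×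
  (∀ u v → NonEmpty u → NonEmpty v → w ≡ u ++ v → w <lex (v ++ u))

IsDecLyndonFact : Word → List Word → Set
IsDecLyndonFact w fs =
  (concat fs ≡ w) × All IsLyndon fs × Linked _⪰lex_ fs

IsSignedPerm : ℕ → Word → Set
IsSignedPerm n w = map proj₁ w ↭ map suc (upTo n)

numPos : Word → ℕ
numPos w = length (filterᵇ proj₂ w)

oddPos : Word → Bool
oddPos u = numPos u % 2 Data.Nat.≡ᵇ 1

numOddFactors numEvenFactors : List Word → ℕ
numOddFactors fs = length (filterᵇ oddPos fs)
numEvenFactors fs = length (filterᵇ (λ u → not (oddPos u)) fs)

CSet : ℕ → ℕ → ℕ → Word → Set
CSet n k k̄ w = IsSignedPerm n w ×
  ∃[ fs ] (IsDecLyndonFact w fs × numOddFactors fs ≡ k × numEvenFactors fs ≡ k̄)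

IsPerm : ℕ → List ℕ → Set
IsPerm n w = w ↭ map suc (upTo n)

lrMinsFrom : Maybe ℕ → List ℕ → ℕ
lrMinsFrom m [] = 0
lrMinsFrom nothing (x ∷ xs) = suc (lrMinsFrom (just x) xs)
lrMinsFrom (just m) (x ∷ xs) =
  if x <ᵇ m then suc (lrMinsFrom (just x) xs) else lrMinsFrom (just m) xs

lrMins : List ℕ → ℕ
lrMins = lrMinsFrom nothing

StirSet : ℕ → ℕ → List ℕ → Set
StirSet n j w = IsPerm n w × lrMins w ≡ j

Enumerates : {A : Set} → (A → Set) → List A → Set
Enumerates {A} P L = Data.List.Relation.Unary.Unique.Propositional.Unique L ×
  (∀ (a : A) → (Data.List.Membership.Propositional._∈_ a L → P a) × (P a → Data.List.Membership.Propositional._∈_ a L))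

-- For a word with distinct values the decreasing Lyndon factorisation cuts the word before each
-- left-to-right minimum of its values: a factor led by its least letter is Lyndon, and decreasing
-- leaders make the factors lexicographically decreasing; conversely the leader of a Lyndon factor
-- of such a word is its least letter, and consecutive leaders decrease. So a signed permutation
-- over a permutation p with j left-to-right minima has exactly j factors. Changing the sign of a
-- factor's leader toggles the parity of that factor alone, whatever the signs of the n − j other
-- letters; hence p carries 2^(n−j) · binom(j, k) signings with k odd factors.
module Submission where

open import Data.Bool using (Bool; true; false; if_then_else_; not; T)
open import Data.Bool.Properties using (not-involutive)
open import Data.Empty using (⊥; ⊥-elim)
open import Data.List using (List; []; _∷_; _++_; map; length; filterᵇ; upTo; concat; concatMap)
open import Data.List.Membership.Propositional using (_∈_; find; lose)
open import Data.List.Membership.Propositional.Properties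
  using (∈-∃++; ∈-map⁺; ∈-map⁻; ∈-++⁺ˡ; ∈-++⁺ʳ; ∈-++⁻; ∈-filter⁺; ∈-filter⁻; ∈-concatMap⁺; ∈-concatMap⁻)
open import Data.List.Membership.Propositional.Properties.WithK using (unique∧set⇒bag)
open import Data.List.Properties using (∷-injectiveʳ; filter-++; length-++; length-map; length-upTo)
open import Data.List.Relation.Binary.BagAndSetEquality using (∼bag⇒↭)
open import Data.List.Relation.Binary.Disjoint.Propositional using (Disjoint)
open import Data.List.Relation.Binary.Permutation.Propositional using (↭-sym; ↭⇒↭ₛ)
open import Data.List.Relation.Binary.Permutation.Propositional.Properties using (↭-length)
import Data.List.Relation.Binary.Permutation.Setoid.Properties as Permutation
open import Data.List.Relation.Unary.All as All using (All; []; _∷_)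
import Data.List.Relation.Unary.All.Properties as All
open import Data.List.Relation.Unary.AllPairs as AllPairs using ([]; _∷_)
import Data.List.Relation.Unary.AllPairs.Properties as AllPairs
open import Data.List.Relation.Unary.Any using (here; there)
open import Data.List.Relation.Unary.Linked using (Linked; []; [-]; _∷_)
open import Data.List.Relation.Unary.Unique.Propositional using (Unique)
import Data.List.Relation.Unary.Unique.Propositional.Properties as Unique
open import Data.Maybe using (Maybe; just; nothing)
open import Data.Nat using (ℕ; zero; suc; _+_; _*_; _∸_; _^_; _≤_; _<_; _%_; _≡ᵇ_; z≤n; s≤s)
open import Data.Nat.Combinatorics using (_C_; nCk+nC[k+1]≡[n+1]C[k+1])
open import Data.Nat.Properties
open import Algebra.Properties.CommutativeSemigroup +-commutativeSemigroup
  using () renaming (interchange to +-interchange)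
open import Data.Product using (_×_; _,_; proj₁; proj₂)
open import Data.Sum using (inj₁; inj₂)
open import Data.Unit using (⊤; tt)
open import Function using (_∘_)
open import Function.Bundles using (_⇔_; mk⇔; Equivalence)
open import Relation.Binary.PropositionalEquality
open import Relation.Nullary using (¬_; Dec; yes; no; does)
open import Relation.Nullary.Decidable using (T?)

open import Defs

bit : Bool → ℕ
bit b = if b then 1 else 0

bit≤1 : ∀ b → bit b ≤ 1
bit≤1 true  = s≤s z≤n
bit≤1 false = z≤n

length-filterᵇ-∷ : ∀ {A : Set} (P : A → Bool) x xs →
  length (filterᵇ P (x ∷ xs)) ≡ bit (P x) + length (filterᵇ P xs)
length-filterᵇ-∷ P x xs with P x
... | true  = refl
... | false = refl

length-filterᵇ-++ : ∀ {A : Set} (P : A → Bool) xs ys →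
  length (filterᵇ P (xs ++ ys)) ≡ length (filterᵇ P xs) + length (filterᵇ P ys)
length-filterᵇ-++ P xs ys = trans (cong length (filter-++ (T? ∘ P) xs ys)) (length-++ (filterᵇ P xs))

length-filterᵇ-map : ∀ {A B : Set} (P : B → Bool) (f : A → B) xs →
  length (filterᵇ P (map f xs)) ≡ length (filterᵇ (P ∘ f) xs)
length-filterᵇ-map P f []       = refl
length-filterᵇ-map P f (x ∷ xs) = begin
  length (filterᵇ P (f x ∷ map f xs))        ≡⟨ length-filterᵇ-∷ P (f x) (map f xs) ⟩
  bit (P (f x)) + length (filterᵇ P (map f xs)) ≡⟨ cong (bit (P (f x)) +_) (length-filterᵇ-map P f xs) ⟩
  bit (P (f x)) + length (filterᵇ (P ∘ f) xs)  ≡⟨ length-filterᵇ-∷ (P ∘ f) x xs ⟨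
  length (filterᵇ (P ∘ f) (x ∷ xs))          ∎
  where open ≡-Reasoning

length-filterᵇ-false : ∀ {A : Set} (xs : List A) → length (filterᵇ (λ _ → false) xs) ≡ 0
length-filterᵇ-false []       = refl
length-filterᵇ-false (_ ∷ xs) = length-filterᵇ-false xs

length-filterᵇ-+-not : ∀ {A : Set} (P : A → Bool) xs →
  length (filterᵇ P xs) + length (filterᵇ (not ∘ P) xs) ≡ length xs
length-filterᵇ-+-not P []       = refl
length-filterᵇ-+-not P (x ∷ xs) with P x
... | true  = cong suc (length-filterᵇ-+-not P xs)
... | false = trans (+-suc _ _) (cong suc (length-filterᵇ-+-not P xs))

length-filterᵇ-pairs : ∀ {A : Set} (P Q P′ Q′ : A → Bool) →
  (∀ x → bit (P x) + bit (Q x) ≡ bit (P′ x) + bit (Q′ x)) → ∀ xs →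
  length (filterᵇ P xs) + length (filterᵇ Q xs) ≡ length (filterᵇ P′ xs) + length (filterᵇ Q′ xs)
length-filterᵇ-pairs P Q P′ Q′ pointwise []       = refl
length-filterᵇ-pairs P Q P′ Q′ pointwise (x ∷ xs) = begin
  length (filterᵇ P (x ∷ xs)) + length (filterᵇ Q (x ∷ xs))
    ≡⟨ cong₂ _+_ (length-filterᵇ-∷ P x xs) (length-filterᵇ-∷ Q x xs) ⟩
  (bit (P x) + #P) + (bit (Q x) + #Q)     ≡⟨ +-interchange (bit (P x)) #P (bit (Q x)) #Q ⟩
  (bit (P x) + bit (Q x)) + (#P + #Q)     ≡⟨ cong₂ _+_ (pointwise x) (length-filterᵇ-pairs P Q P′ Q′ pointwise xs) ⟩
  (bit (P′ x) + bit (Q′ x)) + (#P′ + #Q′) ≡⟨ +-interchange (bit (P′ x)) (bit (Q′ x)) #P′ #Q′ ⟩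
  (bit (P′ x) + #P′) + (bit (Q′ x) + #Q′)
    ≡⟨ cong₂ _+_ (length-filterᵇ-∷ P′ x xs) (length-filterᵇ-∷ Q′ x xs) ⟨
  length (filterᵇ P′ (x ∷ xs)) + length (filterᵇ Q′ (x ∷ xs)) ∎
  where
  open ≡-Reasoning
  #P  = length (filterᵇ P xs)
  #Q  = length (filterᵇ Q xs)
  #P′ = length (filterᵇ P′ xs)
  #Q′ = length (filterᵇ Q′ xs)

length-concatMap-const : ∀ {A B : Set} (f : A → List B) xs c → (∀ {x} → x ∈ xs → length (f x) ≡ c) →
  length (concatMap f xs) ≡ length xs * c
length-concatMap-const f []       c _      = refl
length-concatMap-const f (x ∷ xs) c len≡c =
  trans (length-++ (f x)) (cong₂ _+_ (len≡c (here refl)) (length-concatMap-const f xs c (len≡c ∘ there)))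

Enumerates-length : ∀ {A : Set} {P : A → Set} {L L′ : List A} →
  Enumerates P L → Enumerates P L′ → length L ≡ length L′
Enumerates-length (L-unique , L-exact) (L′-unique , L′-exact) =
  ↭-length (∼bag⇒↭ (unique∧set⇒bag L-unique L′-unique λ {x} →
    mk⇔ (proj₂ (L′-exact x) ∘ proj₁ (L-exact x)) (proj₂ (L-exact x) ∘ proj₁ (L′-exact x))))

IsPerm-unique : ∀ n {p} → IsPerm n p → Unique p
IsPerm-unique n p↭ =
  Permutation.Unique-resp-↭ (setoid ℕ) (↭⇒↭ₛ (↭-sym p↭)) (Unique.map⁺ suc-injective (Unique.upTo⁺ n))

IsPerm-length : ∀ n {p} → IsPerm n p → length p ≡ n
IsPerm-length n p↭ = trans (↭-length p↭) (trans (length-map suc (upTo n)) (length-upTo n))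

val : Letter → ℕ
val = proj₁

vals : Word → List ℕ
vals = map val

Unique-vals-++⁻ʳ : ∀ u {w} → Unique (vals (u ++ w)) → Unique (vals w)
Unique-vals-++⁻ʳ []      d       = d
Unique-vals-++⁻ʳ (_ ∷ u) (_ ∷ d) = Unique-vals-++⁻ʳ u d

val<⇒≺ : ∀ {x y} → val x < val y → x ≺ y
val<⇒≺ {i , b} {j , c} i<j = begin-strict
  2 * i + bit b  ≤⟨ +-monoʳ-≤ (2 * i) (bit≤1 b) ⟩
  2 * i + 1      <⟨ +-monoʳ-< (2 * i) (s≤s (s≤s z≤n)) ⟩
  2 * i + 2      ≡⟨ +-comm (2 * i) 2 ⟩
  2 + 2 * i      ≡⟨ *-suc 2 i ⟨
  2 * suc i      ≤⟨ *-monoʳ-≤ 2 i<j ⟩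
  2 * j          ≤⟨ m≤m+n (2 * j) (bit c) ⟩
  2 * j + bit c  ∎
  where open ≤-Reasoning

key≤⇒val≤ : ∀ {x y} → key x ≤ key y → val x ≤ val y
key≤⇒val≤ kx≤ky = ≮⇒≥ (λ vy<vx → <⇒≱ (val<⇒≺ vy<vx) kx≤ky)

key≡⇒val≡ : ∀ {x y} → key x ≡ key y → val x ≡ val y
key≡⇒val≡ kx≡ky = ≤-antisym (key≤⇒val≤ (≤-reflexive kx≡ky)) (key≤⇒val≤ (≤-reflexive (sym kx≡ky)))

Below : Maybe ℕ → ℕ → Set
Below nothing  _ = ⊤
Below (just m) x = x < m

below? : ∀ st x → Dec (Below st x)
below? nothing  _ = yes tt
below? (just m) x = x <? m

startFactor extendFactor : Letter → Word × List Word → Word × List Word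
startFactor  x (u , fs) = [] , (x ∷ u) ∷ fs
extendFactor x (u , fs) = x ∷ u , fs

-- st is the running minimum of the values read so far (nothing at the start of the word), as in
-- lrMinsFrom. The result is the prefix of w that continues the factor open before w, followed by
-- the factors that begin inside w, one at each new left-to-right minimum.
lrFactorsFrom : Maybe ℕ → Word → Word × List Word
lrFactorsFrom st []      = [] , []
lrFactorsFrom st (x ∷ w) =
  if does (below? st (val x))
    then startFactor x (lrFactorsFrom (just (val x)) w)
    else extendFactor x (lrFactorsFrom st w)

lrFactors : Word → List Word
lrFactors w = proj₂ (lrFactorsFrom nothing w)

lrMinsFrom-∷ : ∀ st x p → lrMinsFrom st (x ∷ p) ≡
  (if does (below? st x) then suc (lrMinsFrom (just x) p) else lrMinsFrom st p)
lrMinsFrom-∷ nothing  x p = refl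
lrMinsFrom-∷ (just m) x p = refl

lrMinsFrom≤length : ∀ st p → lrMinsFrom st p ≤ length p
lrMinsFrom≤length st []      = z≤n
lrMinsFrom≤length st (x ∷ p) rewrite lrMinsFrom-∷ st x p with below? st x
... | yes _ = s≤s (lrMinsFrom≤length (just x) p)
... | no  _ = m≤n⇒m≤1+n (lrMinsFrom≤length st p)

lrFactorsFrom-++ : ∀ st w → let (u , fs) = lrFactorsFrom st w in u ++ concat fs ≡ w
lrFactorsFrom-++ st []      = refl
lrFactorsFrom-++ st (x ∷ w) with below? st (val x)
... | yes _ = cong (x ∷_) (lrFactorsFrom-++ (just (val x)) w)
... | no  _ = cong (x ∷_) (lrFactorsFrom-++ st w)

concat-lrFactors : ∀ w → concat (lrFactors w) ≡ w
concat-lrFactors []      = refl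
concat-lrFactors (x ∷ w) = lrFactorsFrom-++ nothing (x ∷ w)

length-lrFactorsFrom : ∀ st w → length (proj₂ (lrFactorsFrom st w)) ≡ lrMinsFrom st (vals w)
length-lrFactorsFrom st []      = refl
length-lrFactorsFrom st (x ∷ w) rewrite lrMinsFrom-∷ st (val x) (vals w) with below? st (val x)
... | yes _ = cong suc (length-lrFactorsFrom (just (val x)) w)
... | no  _ = length-lrFactorsFrom st w

open-factor-not-below : ∀ st w → All (λ y → ¬ Below st (val y)) (proj₁ (lrFactorsFrom st w))
open-factor-not-below st []      = []
open-factor-not-below st (x ∷ w) with below? st (val x)
... | yes _       = []
... | no  x-above = x-above ∷ open-factor-not-below st w

All-open-factor : ∀ {P : Letter → Set} st w → All P w → All P (proj₁ (lrFactorsFrom st w))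
All-open-factor st w Pw =
  All.++⁻ˡ (proj₁ (lrFactorsFrom st w)) (subst (All _) (sym (lrFactorsFrom-++ st w)) Pw)

data MinimaChain : Maybe ℕ → List Word → Set where
  []  : ∀ {st} → MinimaChain st []
  _∷_ : ∀ {st x u fs} → Below st (val x) × All (λ y → val x < val y) u →
        MinimaChain (just (val x)) fs → MinimaChain st ((x ∷ u) ∷ fs)

leader-least⇒Lyndon : ∀ {x u} → All (λ y → val x < val y) u → IsLyndon (x ∷ u)
leader-least⇒Lyndon {x} {u} x<u = (λ ()) , rotation-greater
  where
  rotation-greater : ∀ v v′ → NonEmpty v → NonEmpty v′ → x ∷ u ≡ v ++ v′ → (x ∷ u) <lex (v′ ++ v)
  rotation-greater []      _        v≢[] _     _  = ⊥-elim (v≢[] refl)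
  rotation-greater (_ ∷ _) []       _    v′≢[] _  = ⊥-elim (v′≢[] refl)
  rotation-greater (_ ∷ v) (y ∷ v′) _    _     eq with refl ← ∷-injectiveʳ eq =
    here (val<⇒≺ (All.lookup x<u (∈-++⁺ʳ v (here refl))))

Lyndon⇒leader-least : ∀ {x u} → IsLyndon (x ∷ u) → All (λ z → val x ≢ val z) u → All (λ z → val x < val z) u
Lyndon⇒leader-least {x} {u} (_ , rotation-greater) x≢u = All.tabulate leader<
  where
  leader< : ∀ {z} → z ∈ u → val x < val z
  leader< z∈u with ∈-∃++ z∈u
  ... | u₁ , u₂ , refl with rotation-greater (x ∷ u₁) (_ ∷ u₂) (λ ()) (λ ()) refl
  ...   | here x≺z      = ≤∧≢⇒< (key≤⇒val≤ (<⇒≤ x≺z)) (All.lookup x≢u z∈u)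
  ...   | there kx≡kz _ = ⊥-elim (All.lookup x≢u z∈u (key≡⇒val≡ kx≡kz))

⪰lex⇒leader≥ : ∀ {x u y v} → (x ∷ u) ⪰lex (y ∷ v) → val y ≤ val x
⪰lex⇒leader≥ (inj₁ (here y≺x))      = key≤⇒val≤ (<⇒≤ y≺x)
⪰lex⇒leader≥ (inj₁ (there ky≡kx _)) = ≤-reflexive (key≡⇒val≡ ky≡kx)
⪰lex⇒leader≥ (inj₂ refl)            = ≤-refl

MinimaChain⇒Lyndon : ∀ {st fs} → MinimaChain st fs → All IsLyndon fs
MinimaChain⇒Lyndon []               = []
MinimaChain⇒Lyndon ((_ , x<u) ∷ c) = leader-least⇒Lyndon x<u ∷ MinimaChain⇒Lyndon c

MinimaChain⇒decreasing : ∀ {st fs} → MinimaChain st fs → Linked _⪰lex_ fs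
MinimaChain⇒decreasing []                      = []
MinimaChain⇒decreasing (_ ∷ [])                = [-]
MinimaChain⇒decreasing (_ ∷ c@((y<x , _) ∷ _)) = inj₁ (here (val<⇒≺ y<x)) ∷ MinimaChain⇒decreasing c

lrFactorsFrom-MinimaChain : ∀ st w → Unique (vals w) → MinimaChain st (proj₂ (lrFactorsFrom st w))
lrFactorsFrom-MinimaChain st []      _ = []
lrFactorsFrom-MinimaChain st (x ∷ w) (x∉w ∷ w-unique) with below? st (val x)
... | yes x-below = (x-below , x<open-factor) ∷ lrFactorsFrom-MinimaChain (just (val x)) w w-unique
  where
  x<open-factor : All (λ y → val x < val y) (proj₁ (lrFactorsFrom (just (val x)) w))
  x<open-factor = All.zipWith (λ (x≢y , y≮x) → ≤∧≢⇒< (≮⇒≥ y≮x) x≢y)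
    (All-open-factor (just (val x)) w (All.map⁻ x∉w) , open-factor-not-below (just (val x)) w)
... | no  _       = lrFactorsFrom-MinimaChain st w w-unique

MinimaChain-lrFactorsFrom : ∀ {st fs} → MinimaChain st fs → ∀ u → All (λ y → ¬ Below st (val y)) u →
  lrFactorsFrom st (u ++ concat fs) ≡ (u , fs)
MinimaChain-lrFactorsFrom {st} c (y ∷ u) (y-above ∷ u-above) with below? st (val y)
... | yes y-below = ⊥-elim (y-above y-below)
... | no  _       = cong (extendFactor y) (MinimaChain-lrFactorsFrom c u u-above)
MinimaChain-lrFactorsFrom [] [] [] = refl
MinimaChain-lrFactorsFrom {st} (_∷_ {x = x} {u} (x-below , x<u) c) [] [] with below? st (val x)
... | yes _       = cong (startFactor x) (MinimaChain-lrFactorsFrom c u (All.map <⇒≯ x<u))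
... | no  x-above = ⊥-elim (x-above x-below)

decreasingLyndon⇒MinimaChain : ∀ {st x u} fs → Below st (val x) →
  All IsLyndon ((x ∷ u) ∷ fs) → Linked _⪰lex_ ((x ∷ u) ∷ fs) → Unique (vals (concat ((x ∷ u) ∷ fs))) →
  MinimaChain st ((x ∷ u) ∷ fs)
decreasingLyndon⇒MinimaChain {x = x} {u} fs x-below (x∷u-lyndon ∷ fs-lyndon) decreasing (x∉ ∷ d) =
  (x-below , Lyndon⇒leader-least x∷u-lyndon (proj₁ x≢u++fs))
  ∷ next-leaders fs fs-lyndon decreasing (proj₂ x≢u++fs) (Unique-vals-++⁻ʳ u d)
  where
  x≢u++fs : All (λ z → val x ≢ val z) u × All (λ z → val x ≢ val z) (concat fs)
  x≢u++fs = All.++⁻ u (All.map⁻ x∉)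
  next-leaders : ∀ fs → All IsLyndon fs → Linked _⪰lex_ ((x ∷ u) ∷ fs) →
    All (λ z → val x ≢ val z) (concat fs) → Unique (vals (concat fs)) → MinimaChain (just (val x)) fs
  next-leaders []             _               _                  _         _ = []
  next-leaders ([] ∷ _)       ([]-lyndon ∷ _) _                  _         _ = ⊥-elim (proj₁ []-lyndon refl)
  next-leaders ((_ ∷ _) ∷ fs) lyndon          (x⪰y ∷ decreasing) (x≢y ∷ _) d =
    decreasingLyndon⇒MinimaChain fs (≤∧≢⇒< (⪰lex⇒leader≥ x⪰y) (x≢y ∘ sym)) lyndon decreasing d

DecLyndonFact⇒MinimaChain : ∀ {w fs} → Unique (vals w) → IsDecLyndonFact w fs → MinimaChain nothing fs
DecLyndonFact⇒MinimaChain {fs = []}            _ _                        = []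
DecLyndonFact⇒MinimaChain {fs = [] ∷ _}        _ (_ , []-lyndon ∷ _ , _) = ⊥-elim (proj₁ []-lyndon refl)
DecLyndonFact⇒MinimaChain {fs = (_ ∷ _) ∷ fs} d (refl , lyndon , decreasing) =
  decreasingLyndon⇒MinimaChain fs tt lyndon decreasing d

lrFactors-isDecLyndonFact : ∀ w → Unique (vals w) → IsDecLyndonFact w (lrFactors w)
lrFactors-isDecLyndonFact w d = concat-lrFactors w , MinimaChain⇒Lyndon chain , MinimaChain⇒decreasing chain
  where
  chain : MinimaChain nothing (lrFactors w)
  chain = lrFactorsFrom-MinimaChain nothing w d

DecLyndonFact-unique : ∀ {w fs} → Unique (vals w) → IsDecLyndonFact w fs → fs ≡ lrFactors w
DecLyndonFact-unique d fact@(refl , _) =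
  sym (cong proj₂ (MinimaChain-lrFactorsFrom (DecLyndonFact⇒MinimaChain d fact) [] []))

signings : List ℕ → List Word
signings []      = [] ∷ []
signings (x ∷ p) = map ((x , false) ∷_) (signings p) ++ map ((x , true) ∷_) (signings p)

∈-signings⁻ : ∀ p {w} → w ∈ signings p → vals w ≡ p
∈-signings⁻ []      (here refl) = refl
∈-signings⁻ (x ∷ p) w∈ with ∈-++⁻ (map ((x , false) ∷_) (signings p)) w∈
... | inj₁ w∈₀ with _ , w′∈ , refl ← ∈-map⁻ ((x , false) ∷_) w∈₀ = cong (x ∷_) (∈-signings⁻ p w′∈)
... | inj₂ w∈₁ with _ , w′∈ , refl ← ∈-map⁻ ((x , true)  ∷_) w∈₁ = cong (x ∷_) (∈-signings⁻ p w′∈)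

∈-signings⁺ : ∀ w → w ∈ signings (vals w)
∈-signings⁺ []                = here refl
∈-signings⁺ ((x , false) ∷ w) = ∈-++⁺ˡ (∈-map⁺ ((x , false) ∷_) (∈-signings⁺ w))
∈-signings⁺ ((x , true)  ∷ w) = ∈-++⁺ʳ _ (∈-map⁺ ((x , true) ∷_) (∈-signings⁺ w))

signings-unique : ∀ p → Unique (signings p)
signings-unique []      = [] ∷ []
signings-unique (x ∷ p) =
  Unique.++⁺ (Unique.map⁺ ∷-injectiveʳ (signings-unique p)) (Unique.map⁺ ∷-injectiveʳ (signings-unique p))
             signs-differ
  where
  signs-differ : ∀ {w} → w ∈ map ((x , false) ∷_) (signings p) × w ∈ map ((x , true) ∷_) (signings p) → ⊥
  signs-differ (w∈₀ , w∈₁)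
    with _ , _ , refl ← ∈-map⁻ ((x , false) ∷_) w∈₀ | _ , _ , () ← ∈-map⁻ ((x , true) ∷_) w∈₁

length-filterᵇ-signings : ∀ (P : Word → Bool) x p → length (filterᵇ P (signings (x ∷ p))) ≡
  length (filterᵇ (P ∘ ((x , false) ∷_)) (signings p)) + length (filterᵇ (P ∘ ((x , true) ∷_)) (signings p))
length-filterᵇ-signings P x p = trans (length-filterᵇ-++ P (map ((x , false) ∷_) (signings p)) _)
  (cong₂ _+_ (length-filterᵇ-map P _ (signings p)) (length-filterᵇ-map P _ (signings p)))

isOdd-suc : ∀ n → (suc n % 2 ≡ᵇ 1) ≡ not (n % 2 ≡ᵇ 1)
isOdd-suc zero    = refl
isOdd-suc (suc n) = sym (trans (cong not (isOdd-suc n)) (not-involutive _))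

oddPos-positive : ∀ x u → oddPos ((x , true) ∷ u) ≡ not (oddPos u)
oddPos-positive x u = isOdd-suc (numPos u)

numOddFactors-∷ : ∀ f fs → numOddFactors (f ∷ fs) ≡ bit (oddPos f) + numOddFactors fs
numOddFactors-∷ = length-filterᵇ-∷ oddPos

numOdd+numEven≡length : ∀ fs → numOddFactors fs + numEvenFactors fs ≡ length fs
numOdd+numEven≡length = length-filterᵇ-+-not oddPos

leader-sign-flips-parity : ∀ x u fs k →
  bit (numOddFactors (((x , false) ∷ u) ∷ fs) ≡ᵇ k) + bit (numOddFactors (((x , true) ∷ u) ∷ fs) ≡ᵇ k)
  ≡ bit (numOddFactors fs ≡ᵇ k) + bit (suc (numOddFactors fs) ≡ᵇ k)
leader-sign-flips-parity x u fs k
  rewrite numOddFactors-∷ ((x , false) ∷ u) fs | numOddFactors-∷ ((x , true) ∷ u) fs | oddPos-positive x u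
  with oddPos u
... | true  = +-comm (bit (suc (numOddFactors fs) ≡ᵇ k)) (bit (numOddFactors fs ≡ᵇ k))
... | false = refl

hasOddFactors : Maybe ℕ → ℕ → Word → Bool
hasOddFactors st k w = numOddFactors (proj₂ (lrFactorsFrom st w)) ≡ᵇ k

oddFactorSignings : Maybe ℕ → ℕ → List ℕ → List Word
oddFactorSignings st k p = filterᵇ (hasOddFactors st k) (signings p)

length-oddFactorSignings : ∀ st k p →
  length (oddFactorSignings st k p) ≡ 2 ^ (length p ∸ lrMinsFrom st p) * (lrMinsFrom st p C k)
length-oddFactorSignings st zero    []      = refl
length-oddFactorSignings st (suc k) []      = refl
length-oddFactorSignings st k       (x ∷ p)
  rewrite length-filterᵇ-signings (hasOddFactors st k) x p | lrMinsFrom-∷ st x p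
  with below? st x
... | yes _ = trans
  (length-filterᵇ-pairs _ _ _ _ (λ w → leader-sign-flips-parity x (proj₁ (rest w)) (proj₂ (rest w)) k) (signings p))
  (pascal k)
  where
  L 2^e : ℕ
  L = lrMinsFrom (just x) p
  2^e = 2 ^ (length p ∸ L)
  rest : Word → Word × List Word
  rest = lrFactorsFrom (just x)
  pascal : ∀ k → length (oddFactorSignings (just x) k p)
                 + length (filterᵇ (λ w → suc (numOddFactors (proj₂ (rest w))) ≡ᵇ k) (signings p))
               ≡ 2^e * (suc L C k)
  pascal zero = trans (cong₂ _+_ (length-oddFactorSignings (just x) zero p) (length-filterᵇ-false (signings p)))
                      (+-identityʳ _)
  pascal (suc k) = begin
    length (oddFactorSignings (just x) (suc k) p) + length (oddFactorSignings (just x) k p)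
      ≡⟨ cong₂ _+_ (length-oddFactorSignings (just x) (suc k) p) (length-oddFactorSignings (just x) k p) ⟩
    2^e * (L C suc k) + 2^e * (L C k)  ≡⟨ *-distribˡ-+ 2^e (L C suc k) (L C k) ⟨
    2^e * (L C suc k + L C k)          ≡⟨ cong (2^e *_) (+-comm (L C suc k) (L C k)) ⟩
    2^e * (L C k + L C suc k)          ≡⟨ cong (2^e *_) (nCk+nC[k+1]≡[n+1]C[k+1] L k) ⟩
    2^e * (suc L C suc k)              ∎
    where open ≡-Reasoning
... | no _ = begin
  #odd + #odd                        ≡⟨ cong (λ c → c + c) (length-oddFactorSignings st k p) ⟩
  2^e * (L C k) + 2^e * (L C k)      ≡⟨ cong (2^e * (L C k) +_) (+-identityʳ (2^e * (L C k))) ⟨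
  2 * (2^e * (L C k))                ≡⟨ *-assoc 2 2^e (L C k) ⟨
  2 ^ suc (length p ∸ L) * (L C k)   ≡⟨ cong (λ e → 2 ^ e * (L C k)) (+-∸-assoc 1 (lrMinsFrom≤length st p)) ⟨
  2 ^ (suc (length p) ∸ L) * (L C k) ∎
  where
  open ≡-Reasoning
  L 2^e #odd : ℕ
  L = lrMinsFrom st p
  2^e = 2 ^ (length p ∸ L)
  #odd = length (oddFactorSignings st k p)

length-oddFactorSignings-StirSet : ∀ n k k̄ {p} → StirSet n (k + k̄) p →
  length (oddFactorSignings nothing k p) ≡ 2 ^ (n ∸ (k + k̄)) * ((k + k̄) C k)
length-oddFactorSignings-StirSet n k k̄ {p} (p-perm , lrMins≡k+k̄) =
  trans (length-oddFactorSignings nothing k p)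
        (cong₂ (λ m j → 2 ^ (m ∸ j) * (j C k)) (IsPerm-length n p-perm) lrMins≡k+k̄)

∈-oddFactorSignings⁻ : ∀ k p {w} → w ∈ oddFactorSignings nothing k p → vals w ≡ p × T (hasOddFactors nothing k w)
∈-oddFactorSignings⁻ k p w∈ with w∈signings , has-k-odd ← ∈-filter⁻ (T? ∘ hasOddFactors nothing k) w∈ =
  ∈-signings⁻ p w∈signings , has-k-odd

∈-oddFactorSignings⁺ : ∀ k w → T (hasOddFactors nothing k w) → w ∈ oddFactorSignings nothing k (vals w)
∈-oddFactorSignings⁺ k w = ∈-filter⁺ (T? ∘ hasOddFactors nothing k) (∈-signings⁺ w)

CSet⇔StirSet×hasOddFactors : ∀ n k k̄ w →
  CSet n k k̄ w ⇔ (StirSet n (k + k̄) (vals w) × T (hasOddFactors nothing k w))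
CSet⇔StirSet×hasOddFactors n k k̄ w = mk⇔ to from
  where
  to : CSet n k k̄ w → StirSet n (k + k̄) (vals w) × T (hasOddFactors nothing k w)
  to (w-perm , fs , fact , odd , even) with refl ← DecLyndonFact-unique (IsPerm-unique n w-perm) fact =
    (w-perm , lrMins≡k+k̄) , ≡⇒≡ᵇ _ k odd
    where
    open ≡-Reasoning
    lrMins≡k+k̄ : lrMins (vals w) ≡ k + k̄
    lrMins≡k+k̄ = begin
      lrMins (vals w)                                            ≡⟨ length-lrFactorsFrom nothing w ⟨
      length (lrFactors w)                                       ≡⟨ numOdd+numEven≡length (lrFactors w) ⟨
      numOddFactors (lrFactors w) + numEvenFactors (lrFactors w) ≡⟨ cong₂ _+_ odd even ⟩
      k + k̄                                                      ∎
  from : StirSet n (k + k̄) (vals w) × T (hasOddFactors nothing k w) → CSet n k k̄ w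
  from ((w-perm , lrMins≡k+k̄) , has-k-odd) =
    w-perm , lrFactors w , lrFactors-isDecLyndonFact w (IsPerm-unique n w-perm) , odd , even
    where
    open ≡-Reasoning
    odd : numOddFactors (lrFactors w) ≡ k
    odd = ≡ᵇ⇒≡ _ k has-k-odd
    even : numEvenFactors (lrFactors w) ≡ k̄
    even = +-cancelˡ-≡ k _ _ (begin
      k + numEvenFactors (lrFactors w)                           ≡⟨ cong (_+ _) odd ⟨
      numOddFactors (lrFactors w) + numEvenFactors (lrFactors w) ≡⟨ numOdd+numEven≡length (lrFactors w) ⟩
      length (lrFactors w)                                       ≡⟨ length-lrFactorsFrom nothing w ⟩
      lrMins (vals w)                                            ≡⟨ lrMins≡k+k̄ ⟩
      k + k̄                                                      ∎)

oddFactorSignings-enumerates : ∀ n k k̄ {Lc} → Enumerates (StirSet n (k + k̄)) Lc →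
  Enumerates (CSet n k k̄) (concatMap (oddFactorSignings nothing k) Lc)
oddFactorSignings-enumerates n k k̄ {Lc} (Lc-unique , Lc-exact) = unique , λ w → sound w , complete w
  where
  disjoint : ∀ {p q} → p ≢ q → Disjoint (oddFactorSignings nothing k p) (oddFactorSignings nothing k q)
  disjoint p≢q (w∈p , w∈q) =
    p≢q (trans (sym (proj₁ (∈-oddFactorSignings⁻ k _ w∈p))) (proj₁ (∈-oddFactorSignings⁻ k _ w∈q)))
  unique : Unique (concatMap (oddFactorSignings nothing k) Lc)
  unique = Unique.concat⁺
    (All.map⁺ (All.universal (λ p → Unique.filter⁺ (T? ∘ hasOddFactors nothing k) (signings-unique p)) Lc))
    (AllPairs.map⁺ (AllPairs.map disjoint Lc-unique))
  sound : ∀ w → w ∈ concatMap (oddFactorSignings nothing k) Lc → CSet n k k̄ w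
  sound w w∈ with p , p∈Lc , w∈p ← find (∈-concatMap⁻ (oddFactorSignings nothing k) {xs = Lc} w∈)
             with refl , has-k-odd ← ∈-oddFactorSignings⁻ k p w∈p =
    Equivalence.from (CSet⇔StirSet×hasOddFactors n k k̄ w) (proj₁ (Lc-exact p) p∈Lc , has-k-odd)
  complete : ∀ w → CSet n k k̄ w → w ∈ concatMap (oddFactorSignings nothing k) Lc
  complete w w∈C with stir , has-k-odd ← Equivalence.to (CSet⇔StirSet×hasOddFactors n k k̄ w) w∈C =
    ∈-concatMap⁺ (oddFactorSignings nothing k)
      (lose (proj₂ (Lc-exact (vals w)) stir) (∈-oddFactorSignings⁺ k w has-k-odd))

lemma5p11 : (n k k̄ : ℕ) → 1 ≤ n →
    (LC : List Word) → Enumerates (CSet n k k̄) LC →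
    (Lc : List (List ℕ)) → Enumerates (StirSet n (k + k̄)) Lc →
    length LC ≡ 2 ^ (n ∸ (k + k̄)) * length Lc * ((k + k̄) C k)
lemma5p11 n k k̄ _ LC LC-enum Lc Lc-enum = begin
  length LC
    ≡⟨ Enumerates-length LC-enum (oddFactorSignings-enumerates n k k̄ Lc-enum) ⟩
  length (concatMap (oddFactorSignings nothing k) Lc)
    ≡⟨ length-concatMap-const _ Lc _ block-length ⟩
  length Lc * (2 ^ (n ∸ (k + k̄)) * ((k + k̄) C k)) ≡⟨ *-assoc (length Lc) _ _ ⟨
  length Lc * 2 ^ (n ∸ (k + k̄)) * ((k + k̄) C k)   ≡⟨ cong (_* ((k + k̄) C k)) (*-comm (length Lc) _) ⟩
  2 ^ (n ∸ (k + k̄)) * length Lc * ((k + k̄) C k)   ∎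
  where
  open ≡-Reasoning
  block-length : ∀ {p} → p ∈ Lc → length (oddFactorSignings nothing k p) ≡ 2 ^ (n ∸ (k + k̄)) * ((k + k̄) C k)
  block-length p∈Lc = length-oddFactorSignings-StirSet n k k̄ (proj₁ (proj₂ Lc-enum _) p∈Lc)
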